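{- For all $n,m\ge 0$, the number of Arndt compositions of $n$ with $m$ parts equals the number of reduced anti-palindromic compositions of $n$ with $m$ parts.
   Context: A composition of $n$ is a finite sequence $(\sigma_1,\dots,\sigma_\ell)$ of positive integers summing to $n$, with $\ell$ parts. An Arndt composition is one with $\sigma_{2i-1}>\sigma_{2i}$ for every positive integer $i$ with $2i\le\ell$. A composition is anti-palindromic if $\sigma_i\neq\sigma_{\ell+1-i}$ for all $i$ with $i\neq(\ell+1)/2$. Two anti-palindromic compositions with $\ell$ parts are flip-equivalent if one is obtained from the other by swapping $\sigma_i$ and $\sigma_{\ell+1-i}$ for some set of indices $i<(\ell+1)/2$; a reduced anti-palindromic composition of $n$ with $\ell$ parts is a flip-equivalence class of anti-palindromic compositions of $n$ with $\ell$ parts. -}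

module Defs where

open import Data.Nat using (ℕ; zero; suc; _+_; _*_; _<_; _<ᵇ_)
open import Data.Bool using (Bool; if_then_else_)
open import Data.Fin using (Fin; toℕ; opposite)
open import Data.Vec using (Vec; lookup; sum)
open import Data.Product using (Σ; _×_)
open import Relation.Binary.PropositionalEquality using (_≡_; _≢_)

IsComposition : (n m : ℕ) → Vec ℕ m → Set
IsComposition n m v = ((i : Fin m) → 0 < lookup v i) × (sum v ≡ n)

-- Arndt: σ_{2i-1} > σ_{2i} whenever 2i ≤ m (1-based); 0-based: v[2k] > v[2k+1].
IsArndt : (m : ℕ) → Vec ℕ m → Set
IsArndt m v = (k : ℕ) (i j : Fin m) → toℕ i ≡ 2 * k → toℕ j ≡ suc (2 * k) →
              lookup v j < lookup v i

IsAntiPal : (m : ℕ) → Vec ℕ m → Set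
IsAntiPal m v = (i : Fin m) → i ≢ opposite i → lookup v i ≢ lookup v (opposite i)

-- Given a set S of indices (only indices i with i < opposite i matter),
-- flipIndex S j is the position whose entry lands at j after swapping
-- σ_i and σ_{m+1-i} for each i in S with i in the first half.
flipIndex : {m : ℕ} → (Fin m → Bool) → Fin m → Fin m
flipIndex S j =
  if toℕ j <ᵇ toℕ (opposite j)
  then (if S j then opposite j else j)
  else (if S (opposite j) then opposite j else j)

FlipEquiv : (m : ℕ) → Vec ℕ m → Vec ℕ m → Set
FlipEquiv m v w = Σ (Fin m → Bool) λ S → (j : Fin m) → lookup w j ≡ lookup v (flipIndex S j)

ArndtComp : (n m : ℕ) → Set
ArndtComp n m = Σ (Vec ℕ m) λ v → IsComposition n m v × IsArndt m v

AntiPalComp : (n m : ℕ) → Set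
AntiPalComp n m = Σ (Vec ℕ m) λ v → IsComposition n m v × IsAntiPal m v

{-# OPTIONS --safe #-}
-- Nesting an Arndt composition (σ₁, σ₂, σ₃, σ₄, …) into σ₁ σ₃ ⋯ σ₄ σ₂ puts each Arndt pair
-- σ₂ᵢ₋₁ > σ₂ᵢ on a pair of opposite positions, so the result is anti-palindromic. Two vectors
-- are flip-equivalent exactly when they carry the same unordered pair at every pair of opposite
-- positions. As every Arndt pair is ordered decreasingly, nesting is injective on flip classes;
-- ordering each opposite pair of an anti-palindromic composition decreasingly and un-nesting
-- gives a preimage of its class.
module Submission where

open import Defs
open import Data.Nat using (ℕ; zero; suc; _+_; _*_; _<_; _<ᵇ_; _≟_)
open import Data.Nat.Properties
  using (+-comm; +-assoc; *-suc; suc-injective; <-asym; >⇒≢; <-cmp; ≮⇒≥; ≤-antisym; <ᵇ-reflects-<)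
open import Data.Bool using (Bool; true; false; if_then_else_)
open import Data.Fin using (Fin; zero; suc; toℕ; opposite; fromℕ; inject₁)
open import Data.Fin.Properties using (toℕ-injective; inject₁-injective; opposite-involutive)
  renaming (suc-injective to Fin-suc-injective)
open import Data.Vec using (Vec; []; _∷_; _∷ʳ_; lookup; sum; initLast)
open import Data.Vec.Relation.Unary.All using (All; []; _∷_)
open import Data.Vec.Relation.Unary.All.Properties using (lookup⁺; lookup⁻)
open import Data.Product using (Σ; ∃; ∃₂; _×_; _,_; proj₁; proj₂; swap)
open import Data.Sum using (_⊎_; inj₁; inj₂)
open import Data.Empty using (⊥-elim)
open import Function using (_∘_)
open import Relation.Nullary using (yes; no; contradiction)
open import Relation.Nullary.Decidable using (isNo)
open import Relation.Nullary.Reflects using (ofʸ; ofⁿ)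
open import Relation.Binary using (tri<; tri≈; tri>)
open import Relation.Binary.PropositionalEquality
  using (_≡_; _≢_; refl; sym; trans; cong; subst; subst₂; ≢-sym; module ≡-Reasoning)

private
  variable
    A B : Set
    k m : ℕ

lookup-∷ʳ-fromℕ : (w : Vec A k) (b : A) → lookup (w ∷ʳ b) (fromℕ k) ≡ b
lookup-∷ʳ-fromℕ []      b = refl
lookup-∷ʳ-fromℕ (_ ∷ w) b = lookup-∷ʳ-fromℕ w b

lookup-∷ʳ-inject₁ : (w : Vec A k) (b : A) (j : Fin k) → lookup (w ∷ʳ b) (inject₁ j) ≡ lookup w j
lookup-∷ʳ-inject₁ (_ ∷ w) b zero    = refl
lookup-∷ʳ-inject₁ (_ ∷ w) b (suc j) = lookup-∷ʳ-inject₁ w b j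

sum-∷ʳ : (w : Vec ℕ k) (b : ℕ) → sum (w ∷ʳ b) ≡ sum w + b
sum-∷ʳ []      b = +-comm b 0
sum-∷ʳ (x ∷ w) b = trans (cong (x +_) (sum-∷ʳ w b)) (sym (+-assoc x (sum w) b))

All-∷ʳ⁺ : {P : A → Set} {w : Vec A k} {b : A} → All P w → P b → All P (w ∷ʳ b)
All-∷ʳ⁺ []        pb = pb ∷ []
All-∷ʳ⁺ (px ∷ pw) pb = px ∷ All-∷ʳ⁺ pw pb

All-∷ʳ⁻ : {P : A → Set} (w : Vec A k) {b : A} → All P (w ∷ʳ b) → All P w × P b
All-∷ʳ⁻ []      (pb ∷ []) = [] , pb
All-∷ʳ⁻ (_ ∷ w) (px ∷ p)  = let pw , pb = All-∷ʳ⁻ w p in px ∷ pw , pb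

data LastOrInject : (k : ℕ) → Fin (suc k) → Set where
  last   : LastOrInject k (fromℕ k)
  inject : (j : Fin k) → LastOrInject k (inject₁ j)

lastOrInject : (i : Fin (suc k)) → LastOrInject k i
lastOrInject {zero}  zero    = last
lastOrInject {suc k} zero    = inject zero
lastOrInject {suc k} (suc i) with lastOrInject i
... | last     = last
... | inject j = inject (suc j)

opposite-fromℕ : ∀ k → opposite (fromℕ k) ≡ zero
opposite-fromℕ zero    = refl
opposite-fromℕ (suc k) = cong inject₁ (opposite-fromℕ k)

opposite-inject₁ : (j : Fin k) → opposite (inject₁ j) ≡ suc (opposite j)
opposite-inject₁ {suc k} zero    = refl
opposite-inject₁ {suc k} (suc j) = cong inject₁ (opposite-inject₁ j)

_≋_ : A × A → A × A → Set
p ≋ q = q ≡ p ⊎ q ≡ swap p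

≋-swap : {p q : A × A} → p ≋ q → swap p ≋ swap q
≋-swap (inj₁ refl) = inj₁ refl
≋-swap (inj₂ refl) = inj₂ refl

≋-map : (f : A → B) {x y x′ y′ : A} → (x , y) ≋ (x′ , y′) → (f x , f y) ≋ (f x′ , f y′)
≋-map f (inj₁ refl) = inj₁ refl
≋-map f (inj₂ refl) = inj₂ refl

≋-All : {P : A → Set} {x y x′ y′ : A} → (x , y) ≋ (x′ , y′) → P x → P y → P x′ × P y′
≋-All (inj₁ refl) px py = px , py
≋-All (inj₂ refl) px py = py , px

≋-+ : {x y x′ y′ : ℕ} → (x , y) ≋ (x′ , y′) → ∀ s → x′ + (y′ + s) ≡ x + (y + s)
≋-+ (inj₁ refl) s = refl
≋-+ {x} {y} (inj₂ refl) s = begin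
  y + (x + s) ≡⟨ +-assoc y x s ⟨
  y + x + s   ≡⟨ cong (_+ s) (+-comm y x) ⟩
  x + y + s   ≡⟨ +-assoc x y s ⟩
  x + (y + s) ∎
  where open ≡-Reasoning

descending : {x y : ℕ} → x ≢ y → ∃₂ λ x′ y′ → y′ < x′ × (x , y) ≋ (x′ , y′)
descending {x} {y} x≢y with <-cmp x y
... | tri< x<y _ _ = y , x , x<y , inj₂ refl
... | tri≈ _ x≡y _ = contradiction x≡y x≢y
... | tri> _ _ y<x = x , y , y<x , inj₁ refl

≋-if : ∀ c {x y : A} → (x , y) ≋ ((if c then y else x) , (if c then x else y))
≋-if true  = inj₂ refl
≋-if false = inj₁ refl

pairAt : Vec A m → Fin m → A × A
pairAt v i = lookup v i , lookup v (opposite i)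

SamePairs : Vec A m → Vec A m → Set
SamePairs v w = ∀ i → pairAt v i ≋ pairAt w i

flipIndex-pair : (S : Fin m → Bool) (j : Fin m) →
                 (j , opposite j) ≋ (flipIndex S j , flipIndex S (opposite j))
flipIndex-pair S j rewrite opposite-involutive j
  with toℕ j <ᵇ toℕ (opposite j) | <ᵇ-reflects-< (toℕ j) (toℕ (opposite j))
     | toℕ (opposite j) <ᵇ toℕ j | <ᵇ-reflects-< (toℕ (opposite j)) (toℕ j)
... | true  | ofʸ j<o | true  | ofʸ o<j = ⊥-elim (<-asym j<o o<j)
... | true  | _       | false | _       = ≋-if (S j)
... | false | _       | true  | _       = ≋-if (S (opposite j))
... | false | ofⁿ j≮o | false | ofⁿ o≮j
  rewrite toℕ-injective {i = opposite j} {j = j} (≤-antisym (≮⇒≥ j≮o) (≮⇒≥ o≮j)) with S j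
...   | true  = inj₁ refl
...   | false = inj₁ refl

flipEquiv⇒samePairs : (v w : Vec ℕ m) → FlipEquiv m v w → SamePairs v w
flipEquiv⇒samePairs v w (S , w≡v∘flip) j
  rewrite w≡v∘flip j | w≡v∘flip (opposite j) = ≋-map (lookup v) (flipIndex-pair S j)

samePairs⇒flipEquiv : (v w : Vec ℕ m) → SamePairs v w → FlipEquiv m v w
samePairs⇒flipEquiv {m} v w same = S , λ j → flipped j
  where
  S : Fin m → Bool
  S i = isNo (lookup w i ≟ lookup v i)

  flippedAtSelf : ∀ j → lookup w j ≡ lookup v (if S j then opposite j else j)
  flippedAtSelf j with lookup w j ≟ lookup v j | same j
  ... | yes w≡v | _             = w≡v
  ... | no w≢v  | inj₁ w≡v      = contradiction (cong proj₁ w≡v) w≢v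
  ... | no _    | inj₂ w≡swap-v = cong proj₁ w≡swap-v

  flippedAtOpposite : ∀ j → lookup w j ≡ lookup v (if S (opposite j) then opposite j else j)
  flippedAtOpposite j with lookup w (opposite j) ≟ lookup v (opposite j) | same j
  ... | yes _   | inj₁ w≡v      = cong proj₁ w≡v
  ... | yes w≡v | inj₂ w≡swap-v =
    trans (cong proj₁ w≡swap-v) (trans (sym w≡v) (cong proj₂ w≡swap-v))
  ... | no w≢v  | inj₁ w≡v      = contradiction (cong proj₂ w≡v) w≢v
  ... | no _    | inj₂ w≡swap-v = cong proj₁ w≡swap-v

  -- Each branch of flipIndex picks the right entry for every j, whatever the comparison says.
  flipped : ∀ j → lookup w j ≡ lookup v (flipIndex S j)
  flipped j with toℕ j <ᵇ toℕ (opposite j)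
  ... | true  = flippedAtSelf j
  ... | false = flippedAtOpposite j

surround : A → Vec A k → A → Vec A (suc (suc k))
surround a w b = a ∷ (w ∷ʳ b)

pairAt-surround-first : (a : A) (w : Vec A k) (b : A) → pairAt (surround a w b) zero ≡ (a , b)
pairAt-surround-first a w b = cong (a ,_) (lookup-∷ʳ-fromℕ w b)

pairAt-surround-last : (a : A) (w : Vec A k) (b : A) → pairAt (surround a w b) (suc (fromℕ k)) ≡ (b , a)
pairAt-surround-last {k = k} a w b
  rewrite lookup-∷ʳ-fromℕ w b | opposite-fromℕ k = refl

opposite-surround-inner : (j : Fin k) → opposite {suc (suc k)} (suc (inject₁ j)) ≡ suc (inject₁ (opposite j))
opposite-surround-inner j = cong inject₁ (opposite-inject₁ j)

pairAt-surround-inner : (a : A) (w : Vec A k) (b : A) (j : Fin k) →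
                        pairAt (surround a w b) (suc (inject₁ j)) ≡ pairAt w j
pairAt-surround-inner a w b j
  rewrite opposite-surround-inner j | lookup-∷ʳ-inject₁ w b j | lookup-∷ʳ-inject₁ w b (opposite j) = refl

samePairs-surround⁺ : {a b a′ b′ : A} {w w′ : Vec A k} →
  (a , b) ≋ (a′ , b′) → SamePairs w w′ → SamePairs (surround a w b) (surround a′ w′ b′)
samePairs-surround⁺ {a = a} {b} {a′} {b′} {w} {w′} ab≋ same zero =
  subst₂ _≋_ (sym (pairAt-surround-first a w b)) (sym (pairAt-surround-first a′ w′ b′)) ab≋
samePairs-surround⁺ {a = a} {b} {a′} {b′} {w} {w′} ab≋ same (suc i) with lastOrInject i
... | last     = subst₂ _≋_ (sym (pairAt-surround-last a w b)) (sym (pairAt-surround-last a′ w′ b′))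
                            (≋-swap ab≋)
... | inject j = subst₂ _≋_ (sym (pairAt-surround-inner a w b j)) (sym (pairAt-surround-inner a′ w′ b′ j))
                            (same j)

samePairs-surround⁻ : (a : A) (w : Vec A k) (b : A) {a′ b′ : A} {w′ : Vec A k} →
  SamePairs (surround a w b) (surround a′ w′ b′) → (a , b) ≋ (a′ , b′) × SamePairs w w′
samePairs-surround⁻ a w b {a′} {b′} {w′} same =
  subst₂ _≋_ (pairAt-surround-first a w b) (pairAt-surround-first a′ w′ b′) (same zero) ,
  λ j → subst₂ _≋_ (pairAt-surround-inner a w b j) (pairAt-surround-inner a′ w′ b′ j)
                   (same (suc (inject₁ j)))

fixed-inner⇒fixed : (j : Fin k) → suc (inject₁ j) ≡ opposite (suc (inject₁ j)) → j ≡ opposite j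
fixed-inner⇒fixed j e = inject₁-injective (Fin-suc-injective (trans e (opposite-surround-inner j)))

fixed⇒fixed-inner : (j : Fin k) → j ≡ opposite j → suc (inject₁ j) ≡ opposite (suc (inject₁ j))
fixed⇒fixed-inner j e = trans (cong (suc ∘ inject₁) e) (sym (opposite-surround-inner j))

antiPal-surround⁺ : {a b : ℕ} {w : Vec ℕ k} → a ≢ b → IsAntiPal k w → IsAntiPal (suc (suc k)) (surround a w b)
antiPal-surround⁺ {a = a} {b} {w} a≢b ap zero _ rewrite lookup-∷ʳ-fromℕ w b = a≢b
antiPal-surround⁺ {a = a} {b} {w} a≢b ap (suc i) i≢i′ with lastOrInject i
... | last     = subst (λ (x , y) → x ≢ y) (sym (pairAt-surround-last a w b)) (≢-sym a≢b)
... | inject j = subst (λ (x , y) → x ≢ y) (sym (pairAt-surround-inner a w b j))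
                       (ap j (i≢i′ ∘ fixed⇒fixed-inner j))

antiPal-surround⁻ : (a : ℕ) (w : Vec ℕ k) (b : ℕ) → IsAntiPal (suc (suc k)) (surround a w b) → a ≢ b × IsAntiPal k w
antiPal-surround⁻ a w b ap =
  subst (a ≢_) (lookup-∷ʳ-fromℕ w b) (ap zero λ ()) ,
  λ j j≢j′ → subst (λ (x , y) → x ≢ y) (pairAt-surround-inner a w b j)
                   (ap (suc (inject₁ j)) (λ e → j≢j′ (fixed-inner⇒fixed j e)))

isArndt-[] : IsArndt 0 []
isArndt-[] k ()

isArndt-[_] : (a : ℕ) → IsArndt 1 (a ∷ [])
isArndt-[ a ] k i zero _ ()

isArndt-∷∷⁻ : {a b : ℕ} {v : Vec ℕ m} → IsArndt (suc (suc m)) (a ∷ b ∷ v) → b < a × IsArndt m v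
isArndt-∷∷⁻ arndt =
  arndt 0 zero (suc zero) refl refl ,
  λ k i j i≡ j≡ → arndt (suc k) (suc (suc i)) (suc (suc j))
                    (trans (cong (2 +_) i≡) (sym (*-suc 2 k)))
                    (trans (cong (2 +_) j≡) (cong suc (sym (*-suc 2 k))))

isArndt-∷∷⁺ : {a b : ℕ} {v : Vec ℕ m} → b < a → IsArndt m v → IsArndt (suc (suc m)) (a ∷ b ∷ v)
isArndt-∷∷⁺ {a = a} {b} {v} b<a arndt = go
  where
  shifted : ∀ k i j → toℕ i ≡ 2 + 2 * k → toℕ j ≡ 3 + 2 * k → lookup (a ∷ b ∷ v) j < lookup (a ∷ b ∷ v) i
  shifted k zero          _             ()  _
  shifted k (suc zero)    _             ()  _
  shifted k (suc (suc i)) zero          _   ()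
  shifted k (suc (suc i)) (suc zero)    _   ()
  shifted k (suc (suc i)) (suc (suc j)) i≡ j≡ =
    arndt k i j (suc-injective (suc-injective i≡)) (suc-injective (suc-injective j≡))

  go : IsArndt (suc (suc _)) (a ∷ b ∷ v)
  go zero    zero    (suc zero)    _  _  = b<a
  go zero    zero    zero          _  ()
  go zero    zero    (suc (suc _)) _  ()
  go zero    (suc _) _             () _
  go (suc k) i       j             i≡ j≡ =
    shifted k i j (trans i≡ (*-suc 2 k)) (trans j≡ (cong suc (*-suc 2 k)))

nest : Vec A m → Vec A m
nest []          = []
nest (a ∷ [])    = a ∷ []
nest (a ∷ b ∷ v) = surround a (nest v) b

sum-surround : (a : ℕ) (w : Vec ℕ k) (b : ℕ) → sum (surround a w b) ≡ sum (a ∷ b ∷ w)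
sum-surround a w b = cong (a +_) (trans (sum-∷ʳ w b) (+-comm (sum w) b))

sum-nest : (v : Vec ℕ m) → sum (nest v) ≡ sum v
sum-nest []          = refl
sum-nest (a ∷ [])    = refl
sum-nest (a ∷ b ∷ v) = trans (sum-surround a (nest v) b) (cong (λ s → a + (b + s)) (sum-nest v))

All-nest⁺ : {P : A → Set} {v : Vec A m} → All P v → All P (nest v)
All-nest⁺ []             = []
All-nest⁺ (pa ∷ [])      = pa ∷ []
All-nest⁺ (pa ∷ pb ∷ pv) = pa ∷ All-∷ʳ⁺ (All-nest⁺ pv) pb

isComposition-nest : {n : ℕ} (v : Vec ℕ m) → IsComposition n m v → IsComposition n m (nest v)
isComposition-nest v (positive , sum≡n) =
  lookup⁺ (All-nest⁺ (lookup⁻ {P = 0 <_} {xs = v} positive)) , trans (sum-nest v) sum≡n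

antiPal-nest : (v : Vec ℕ m) → IsArndt m v → IsAntiPal m (nest v)
antiPal-nest []          _     ()
antiPal-nest (a ∷ [])    _     zero zero≢zero = contradiction refl zero≢zero
antiPal-nest (a ∷ b ∷ v) arndt =
  let b<a , arndt-v = isArndt-∷∷⁻ arndt
  in antiPal-surround⁺ (>⇒≢ b<a) (antiPal-nest v arndt-v)

nest-injective : (x y : Vec ℕ m) → IsArndt m x → IsArndt m y → SamePairs (nest x) (nest y) → x ≡ y
nest-injective []          []            _       _       _    = refl
nest-injective (a ∷ [])    (a′ ∷ [])     _       _       same with same zero
... | inj₁ refl = refl
... | inj₂ refl = refl
nest-injective (a ∷ b ∷ x) (a′ ∷ b′ ∷ y) arndt-x arndt-y same
  with isArndt-∷∷⁻ arndt-x | isArndt-∷∷⁻ arndt-y | samePairs-surround⁻ a (nest x) b same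
... | _   , arndt-x′ | _   , arndt-y′ | inj₁ refl , same′ =
  cong (λ v → a ∷ b ∷ v) (nest-injective x y arndt-x′ arndt-y′ same′)
... | b<a , _        | a<b , _        | inj₂ refl , _     = ⊥-elim (<-asym b<a a<b)

arndtRepresentative : (z : Vec ℕ m) → All (0 <_) z → IsAntiPal m z →
  ∃ λ x → All (0 <_) x × sum x ≡ sum z × IsArndt m x × SamePairs z (nest x)
arndtRepresentative []       _  _  = [] , [] , refl , isArndt-[] , λ ()
arndtRepresentative (a ∷ []) pa _  = a ∷ [] , pa , refl , isArndt-[ a ] , λ { zero → inj₁ refl }
arndtRepresentative {suc (suc k)} (a ∷ v) (pa ∷ pv) antiPal with initLast v
... | w , b , refl with All-∷ʳ⁻ w pv | antiPal-surround⁻ a w b antiPal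
... | pw , pb | a≢b , antiPal-w with arndtRepresentative w pw antiPal-w | descending a≢b
... | x , px , sum-x , arndt-x , same-x | c , d , d<c , ab≋cd =
  let pc , pd = ≋-All ab≋cd pa pb in
  c ∷ d ∷ x ,
  pc ∷ pd ∷ px ,
  (begin
    c + (d + sum x) ≡⟨ cong (λ s → c + (d + s)) sum-x ⟩
    c + (d + sum w) ≡⟨ ≋-+ ab≋cd (sum w) ⟩
    a + (b + sum w) ≡⟨ sum-surround a w b ⟨
    sum (surround a w b) ∎) ,
  isArndt-∷∷⁺ d<c arndt-x ,
  samePairs-surround⁺ ab≋cd same-x
  where open ≡-Reasoning

theorem2p10 : (n m : ℕ) →
    Σ (ArndtComp n m → AntiPalComp n m) λ f →
    ((x y : ArndtComp n m) → FlipEquiv m (proj₁ (f x)) (proj₁ (f y)) → proj₁ x ≡ proj₁ y)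
    × ((z : AntiPalComp n m) → ∃ λ (x : ArndtComp n m) → FlipEquiv m (proj₁ z) (proj₁ (f x)))
theorem2p10 n m = nestComposition , injective , surjective
  where
  nestComposition : ArndtComp n m → AntiPalComp n m
  nestComposition (v , composition , arndt) =
    nest v , isComposition-nest v composition , antiPal-nest v arndt

  injective : (x y : ArndtComp n m) → FlipEquiv m (nest (proj₁ x)) (nest (proj₁ y)) → proj₁ x ≡ proj₁ y
  injective (x , _ , arndt-x) (y , _ , arndt-y) flip =
    nest-injective x y arndt-x arndt-y (flipEquiv⇒samePairs (nest x) (nest y) flip)

  surjective : (z : AntiPalComp n m) → ∃ λ (x : ArndtComp n m) → FlipEquiv m (proj₁ z) (nest (proj₁ x))
  surjective (z , (positive , sum≡n) , antiPal)
    with arndtRepresentative z (lookup⁻ {P = 0 <_} {xs = z} positive) antiPal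
  ... | x , px , sum-x , arndt-x , same =
    (x , (lookup⁺ px , trans sum-x sum≡n) , arndt-x) , samePairs⇒flipEquiv z (nest x) same
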